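{- Let $q=p^m$ with $p$ prime, let $g\in\mathrm{Aut}(\mathbb{F}_q)$ have order $p^r$ with $r\ge0$, and let $\mu\in\mathbb{F}_q$. If $K=\{x\in\mathbb{F}_q:\mathrm{tr}_{\mathbb{F}_q/\mathbb{F}_p}(\mu x)=0\}$ is $g$-invariant, then $g(\mu)=\mu$.
   Context: $\mathrm{tr}_{\mathbb{F}_q/\mathbb{F}_p}(x)=\sum_{i=0}^{m-1}x^{p^i}$. -}

module Defs where

open import Level using (Level; _⊔_)
open import Data.Nat using (ℕ; zero; suc; _^_; _<_)
open import Data.Nat.Primality using (Prime)
open import Data.Fin using (Fin)
open import Data.Product using (_×_; Σ)
open import Relation.Nullary using (¬_)
open import Function.Bundles using (Inverse)
open import Algebra.Bundles using (CommutativeRing)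
open import Algebra.Morphism.Structures using (IsRingIsomorphism)
import Relation.Binary.PropositionalEquality as ≡

module _ {c ℓ : Level} (F : CommutativeRing c ℓ) where
  open CommutativeRing F

  IsField : Set (c ⊔ ℓ)
  IsField = (¬ (1# ≈ 0#)) × (∀ x → ¬ (x ≈ 0#) → Σ Carrier λ y → (x * y) ≈ 1#)

  HasCard : ℕ → Set (c ⊔ ℓ)
  HasCard q = Inverse setoid (≡.setoid (Fin q))

  IsAut : (Carrier → Carrier) → Set (c ⊔ ℓ)
  IsAut g = IsRingIsomorphism rawRing rawRing g

  pow : Carrier → ℕ → Carrier
  pow x zero = 1#
  pow x (suc n) = x * pow x n

  trace : ℕ → ℕ → Carrier → Carrier
  trace p zero x = 0#
  trace p (suc i) x = trace p i x + pow x (p ^ i)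

  iter : (Carrier → Carrier) → ℕ → Carrier → Carrier
  iter g zero x = x
  iter g (suc k) x = g (iter g k x)

  IsIdentity : (Carrier → Carrier) → Set (c ⊔ ℓ)
  IsIdentity h = ∀ x → h x ≈ x

  HasOrder : (Carrier → Carrier) → ℕ → Set (c ⊔ ℓ)
  HasOrder g n = IsIdentity (iter g n) × (∀ k → 0 < k → k < n → ¬ IsIdentity (iter g k))

-- Writing μ = g(ν), g-invariance of K and
-- g ∘ tr = tr ∘ g give ker tr(μ·) ⊆ ker tr(ν·), so tr(ν·) = a·tr(μ·) for some a ∈ 𝔽ₚ, and
-- nondegeneracy of the trace form gives ν = aμ. As g fixes 𝔽ₚ, μ = g(ν) = a·g(μ), hence
-- μ = a^(p^r)·g^(p^r)(μ) = aμ because a^p = a and g^(p^r) = id; comparing, g(μ) = μ.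
-- Nondegeneracy holds because tr is a monic polynomial of degree p^(m-1) < q, so it has a
-- nonzero value, which can be rescaled to 1 inside 𝔽ₚ.

module Submission where

open import Level using (Level; _⊔_)
open import Algebra.Bundles using (CommutativeRing; CommutativeMonoid)
open import Algebra.Morphism.Structures using (IsRingHomomorphism; IsRingIsomorphism)
open import Data.Empty using (⊥-elim)
open import Data.Maybe using (nothing)
open import Data.Nat as ℕ using (ℕ; zero; suc; _≤_; _<_; z≤n; s≤s)
open import Data.Nat.Primality using (Prime)
open import Data.Product using (∃; _×_; _,_; proj₁; proj₂)
open import Function using (_∘_)
open import Relation.Nullary using (¬_; yes; no)
open import Function.Bundles using (Inverse)
import Relation.Binary.PropositionalEquality as ≡
open import Relation.Binary.PropositionalEquality using (_≢_)
open import Defs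

module PrimeBinomial where

  open import Data.Nat
  open import Data.Nat.Properties
  open import Data.Nat.Divisibility
  open import Data.Nat.Primality
  open import Data.Nat.Combinatorics
  open import Data.Nat.DivMod using (m*[n/m]≡n)
  open import Data.Sum using (inj₁; inj₂)
  open import Relation.Binary.PropositionalEquality

  prime>1 : ∀ {p} → Prime p → 1 < p
  prime>1 {p} p-prime = nonTrivial⇒n>1 p {{prime⇒nonTrivial p-prime}}

  prime∣p! : ∀ {p} → Prime p → p ∣ p !
  prime∣p! p-prime with prime>1 p-prime
  ... | s≤s _ = m∣m*n _

  prime∤k! : ∀ {p} → Prime p → ∀ k → k < p → p ∤ k !
  prime∤k! p-prime zero    _   p∣1  = <⇒≱ (prime>1 p-prime) (∣⇒≤ p∣1)
  prime∤k! p-prime (suc k) k<p p∣k! with euclidsLemma (suc k) (k !) p-prime p∣k!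
  ... | inj₁ p∣1+k = <⇒≱ k<p (∣⇒≤ p∣1+k)
  ... | inj₂ p∣k!  = prime∤k! p-prime k (<-trans (n<1+n k) k<p) p∣k!

  k![n∸k]!*nCk≡n! : ∀ {n k} → k ≤ n → k ! * (n ∸ k) ! * (n C k) ≡ n !
  k![n∸k]!*nCk≡n! {n} {k} k≤n =
    trans (cong (k ! * (n ∸ k) ! *_) (nCk≡n!/k![n-k]! k≤n)) (m*[n/m]≡n (k![n∸k]!∣n! k≤n))
    where instance _ = k !* (n ∸ k) !≢0

  prime∣pCk : ∀ {p k} → Prime p → 0 < k → k < p → p ∣ p C k
  prime∣pCk {p} {k} p-prime 0<k k<p
    with euclidsLemma (k ! * (p ∸ k) !) (p C k) p-prime
           (subst (p ∣_) (sym (k![n∸k]!*nCk≡n! (<⇒≤ k<p))) (prime∣p! p-prime))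
  ... | inj₂ p∣pCk = p∣pCk
  ... | inj₁ p∣k![p∸k]! with euclidsLemma (k !) ((p ∸ k) !) p-prime p∣k![p∸k]!
  ...   | inj₁ p∣k!     = ⊥-elim (prime∤k! p-prime k k<p p∣k!)
  ...   | inj₂ p∣[p∸k]! = ⊥-elim (prime∤k! p-prime (p ∸ k) (∸-monoʳ-< 0<k (<⇒≤ k<p)) p∣[p∸k]!)

open PrimeBinomial using (prime>1; prime∣pCk)

module RingProperties {c ℓ : Level} (F : CommutativeRing c ℓ) where

  open CommutativeRing F public renaming (Carrier to C)
  open import Relation.Binary.Reasoning.Setoid setoid public
  open import Algebra.Solver.Ring.NaturalCoefficients commutativeSemiring (λ _ _ → nothing) public
  open import Algebra.Properties.Semiring.Mult semiring public renaming (_×_ to _×ℕ_)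
  open import Algebra.Properties.Semiring.Exp semiring public
  open import Algebra.Properties.CommutativeSemiring.Exp commutativeSemiring public
    using (^-distrib-*)
  open import Algebra.Properties.Ring ring public
    using (-‿distribʳ-*; -‿distribˡ-*; x[y-z]≈xy-xz)
  open import Algebra.Properties.Group +-group public
    using ()
    renaming ( x∙y⁻¹≈ε⇒x≈y to x-y≈0⇒x≈y
             ; x≈y⇒x∙y⁻¹≈ε to x≈y⇒x-y≈0
             ; ∙-cancelˡ    to +-cancelˡ
             )

  pow≈^ : ∀ x n → pow F x n ≈ x ^ n
  pow≈^ x zero    = refl
  pow≈^ x (suc n) = *-congˡ (pow≈^ x n)

  1^n≈1 : ∀ n → 1# ^ n ≈ 1#
  1^n≈1 zero    = refl
  1^n≈1 (suc n) = trans (*-identityˡ _) (1^n≈1 n)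

  ι : ℕ → C
  ι n = n ×ℕ 1#

  n×x≈ι[n]*x : ∀ n x → n ×ℕ x ≈ ι n * x
  n×x≈ι[n]*x n x = trans (×-congʳ n (sym (*-identityˡ x))) (sym (×-assoc-* n 1# x))

  ι[m^n]≈ι[m]^n : ∀ m n → ι (m ℕ.^ n) ≈ ι m ^ n
  ι[m^n]≈ι[m]^n m zero    = +-identityʳ 1#
  ι[m^n]≈ι[m]^n m (suc n) = trans (×1-homo-* m (m ℕ.^ n)) (*-congˡ (ι[m^n]≈ι[m]^n m n))

_HasCharacteristic_ : ∀ {c ℓ} → CommutativeRing c ℓ → ℕ → Set ℓ
F HasCharacteristic p = CommutativeRing._≈_ F (RingProperties.ι F p) (CommutativeRing.0# F)

module FieldProperties {c ℓ : Level} (F : CommutativeRing c ℓ) (isField : IsField F) where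

  open RingProperties F public

  1≉0 : 1# ≉ 0#
  1≉0 = proj₁ isField

  inverse : ∀ x → x ≉ 0# → C
  inverse x x≉0 = proj₁ (proj₂ isField x x≉0)

  x*x⁻¹≈1 : ∀ {x} (x≉0 : x ≉ 0#) → x * inverse x x≉0 ≈ 1#
  x*x⁻¹≈1 {x} x≉0 = proj₂ (proj₂ isField x x≉0)

  x*[x⁻¹*y]≈y : ∀ {x} (x≉0 : x ≉ 0#) y → x * (inverse x x≉0 * y) ≈ y
  x*[x⁻¹*y]≈y {x} x≉0 y = trans (sym (*-assoc x _ y)) (trans (*-congʳ (x*x⁻¹≈1 x≉0)) (*-identityˡ y))

  x⁻¹*[x*y]≈y : ∀ {x} (x≉0 : x ≉ 0#) y → inverse x x≉0 * (x * y) ≈ y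
  x⁻¹*[x*y]≈y {x} x≉0 y = begin
    x⁻¹ * (x * y) ≈⟨ *-assoc x⁻¹ x y ⟨
    (x⁻¹ * x) * y ≈⟨ *-congʳ (trans (*-comm x⁻¹ x) (x*x⁻¹≈1 x≉0)) ⟩
    1# * y        ≈⟨ *-identityˡ y ⟩
    y             ∎
    where x⁻¹ = inverse x x≉0

  *-cancelˡ-nonZero : ∀ {z} x y → z ≉ 0# → z * x ≈ z * y → x ≈ y
  *-cancelˡ-nonZero {z} x y z≉0 zx≈zy = begin
    x                        ≈⟨ x⁻¹*[x*y]≈y z≉0 x ⟨
    inverse z z≉0 * (z * x)  ≈⟨ *-congˡ zx≈zy ⟩
    inverse z z≉0 * (z * y)  ≈⟨ x⁻¹*[x*y]≈y z≉0 y ⟩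
    y                        ∎

  x*y≈0⇒y≈0 : ∀ {x y} → x ≉ 0# → x * y ≈ 0# → y ≈ 0#
  x*y≈0⇒y≈0 {x} {y} x≉0 xy≈0 = *-cancelˡ-nonZero y 0# x≉0 (trans xy≈0 (sym (zeroʳ x)))

  *-nonZero : ∀ {x y} → x ≉ 0# → y ≉ 0# → x * y ≉ 0#
  *-nonZero x≉0 y≉0 xy≈0 = y≉0 (x*y≈0⇒y≈0 x≉0 xy≈0)

  x*z≈y*z⇒z≈0 : ∀ {x y z} → x ≉ y → x * z ≈ y * z → z ≈ 0#
  x*z≈y*z⇒z≈0 {x} {y} {z} x≉y xz≈yz = x*y≈0⇒y≈0 (x≉y ∘ x-y≈0⇒x≈y x y) (begin
    (x - y) * z      ≈⟨ distribʳ z x (- y) ⟩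
    x * z + - y * z  ≈⟨ +-congˡ (-‿distribˡ-* y z) ⟨
    x * z - y * z    ≈⟨ x≈y⇒x-y≈0 xz≈yz ⟩
    0#               ∎)

  ^-nonZero : ∀ {x} → x ≉ 0# → ∀ n → x ^ n ≉ 0#
  ^-nonZero x≉0 zero    = 1≉0
  ^-nonZero x≉0 (suc n) = *-nonZero x≉0 (^-nonZero x≉0 n)


module MonicPolynomials {c ℓ : Level} (F : CommutativeRing c ℓ) (isField : IsField F) where

  open FieldProperties F isField
  open import Data.List using (List; []; _∷_; length; _++_; replicate)
  open import Data.List.Relation.Unary.All as All using (All; []; _∷_)
  open import Data.List.Relation.Unary.AllPairs using (AllPairs; []; _∷_)
  
  eval : List C → C → C
  eval []       x = 0#
  eval (c ∷ cs) x = c + x * eval cs x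

  -- The coefficient list c₀ ∷ … ∷ c₍d₋₁₎ ∷ [] stands for the monic polynomial c₀ + c₁X + … + X^d.
  monic : List C → C → C
  monic []       x = 1#
  monic (c ∷ cs) x = c + x * monic cs x

  monic≈eval+x^deg : ∀ cs x → monic cs x ≈ eval cs x + x ^ length cs
  monic≈eval+x^deg []       x = sym (+-identityˡ 1#)
  monic≈eval+x^deg (c ∷ cs) x = begin
    c + x * monic cs x                   ≈⟨ +-congˡ (*-congˡ (monic≈eval+x^deg cs x)) ⟩
    c + x * (eval cs x + x ^ length cs)
      ≈⟨ solve 4 (λ c x e xᵈ → c :+ x :* (e :+ xᵈ) := (c :+ x :* e) :+ x :* xᵈ) refl c x (eval cs x) (x ^ length cs) ⟩
    (c + x * eval cs x) + x * x ^ length cs ∎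

  eval-++ : ∀ as bs x → eval (as ++ bs) x ≈ eval as x + x ^ length as * eval bs x
  eval-++ []       bs x = sym (trans (+-identityˡ _) (*-identityˡ _))
  eval-++ (a ∷ as) bs x = begin
    a + x * eval (as ++ bs) x ≈⟨ +-congˡ (*-congˡ (eval-++ as bs x)) ⟩
    a + x * (eval as x + x ^ length as * eval bs x)
      ≈⟨ solve 5 (λ a x e xⁿ b → a :+ x :* (e :+ xⁿ :* b) := (a :+ x :* e) :+ (x :* xⁿ) :* b)
                 refl a x (eval as x) (x ^ length as) (eval bs x) ⟩
    (a + x * eval as x) + (x * x ^ length as) * eval bs x ∎

  eval-replicate-0 : ∀ k x → eval (replicate k 0#) x ≈ 0#
  eval-replicate-0 zero    x = refl
  eval-replicate-0 (suc k) x = trans (+-identityˡ _) (trans (*-congˡ (eval-replicate-0 k x)) (zeroʳ x))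

  eval-++-monomial : ∀ cs k x → eval (cs ++ 1# ∷ replicate k 0#) x ≈ eval cs x + x ^ length cs
  eval-++-monomial cs k x = begin
    eval (cs ++ 1# ∷ replicate k 0#) x                    ≈⟨ eval-++ cs _ x ⟩
    eval cs x + x ^ length cs * (1# + x * eval (replicate k 0#) x)
      ≈⟨ +-congˡ (*-congˡ (+-congˡ (trans (*-congˡ (eval-replicate-0 k x)) (zeroʳ x)))) ⟩
    eval cs x + x ^ length cs * (1# + 0#)                 ≈⟨ +-congˡ (*-congˡ (+-identityʳ 1#)) ⟩
    eval cs x + x ^ length cs * 1#                        ≈⟨ +-congˡ (*-identityʳ _) ⟩
    eval cs x + x ^ length cs                             ∎

  -- Synthetic division by X - a: the quotient's coefficients are the Horner values at a.
  deflate : C → List C → List C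
  deflate a []       = []
  deflate a (c ∷ cs) = monic (c ∷ cs) a ∷ deflate a cs

  length-deflate : ∀ a cs → length (deflate a cs) ≡.≡ length cs
  length-deflate a []       = ≡.refl
  length-deflate a (c ∷ cs) = ≡.cong suc (length-deflate a cs)

  -- The factorisation f(x) = f(a) + (x - a) q(x), with the subtraction moved across.
  monic-factor : ∀ a c cs x →
    monic (c ∷ cs) x + a * monic (deflate a cs) x ≈ monic (c ∷ cs) a + x * monic (deflate a cs) x
  monic-factor a c [] x =
    solve 3 (λ c a x → (c :+ x :* con 1) :+ a :* con 1 := (c :+ a :* con 1) :+ x :* con 1) refl c a x
  monic-factor a c (d ∷ ds) x = begin
    (c + x * f x) + a * (f a + x * q)
      ≈⟨ solve 6 (λ c x fx a fa q → (c :+ x :* fx) :+ a :* (fa :+ x :* q) := (c :+ a :* fa) :+ x :* (fx :+ a :* q))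
                 refl c x (f x) a (f a) q ⟩
    (c + a * f a) + x * (f x + a * q)  ≈⟨ +-congˡ (*-congˡ (monic-factor a d ds x)) ⟩
    (c + a * f a) + x * (f a + x * q)  ∎
    where
    f = monic (d ∷ ds)
    q = monic (deflate a ds) x

  deflate-root : ∀ {a y} c cs → y ≉ a → monic (c ∷ cs) a ≈ 0# → monic (c ∷ cs) y ≈ 0# →
                 monic (deflate a cs) y ≈ 0#
  deflate-root {a} {y} c cs y≉a fa≈0 fy≈0 = x*z≈y*z⇒z≈0 y≉a (begin
    y * q           ≈⟨ +-identityˡ _ ⟨
    0# + y * q      ≈⟨ +-congʳ fa≈0 ⟨
    f a + y * q     ≈⟨ monic-factor a c cs y ⟨
    f y + a * q     ≈⟨ +-congʳ fy≈0 ⟩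
    0# + a * q      ≈⟨ +-identityˡ _ ⟩
    a * q           ∎)
    where
    f = monic (c ∷ cs)
    q = monic (deflate a cs) y

  roots≤degree : ∀ cs {xs} → AllPairs _≉_ xs → All (λ x → monic cs x ≈ 0#) xs → length xs ≤ length cs
  roots≤degree cs       {[]}     _                []                = z≤n
  roots≤degree []       {x ∷ xs} _                (1≈0 ∷ _)         = ⊥-elim (1≉0 1≈0)
  roots≤degree (c ∷ cs) {x ∷ xs} (x≉xs ∷ distinct) (fx≈0 ∷ fxs≈0) =
    s≤s (≡.subst (length xs ≤_) (length-deflate x cs)
          (roots≤degree (deflate x cs) distinct
            (All.zipWith (λ (x≉y , fy≈0) → deflate-root c cs (x≉y ∘ sym) fx≈0 fy≈0) (x≉xs , fxs≈0))))

module FiniteField {c ℓ : Level} (F : CommutativeRing c ℓ) (isField : IsField F)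
                   (k : ℕ) (card : HasCard F (suc k)) where

  open FieldProperties F isField
  open MonicPolynomials F isField
  open import Relation.Binary using (Decidable)
  open import Data.Fin using (Fin; punchIn; punchOut)
  import Data.Nat.Properties as ℕ
  import Data.Fin.Properties as Fin
  open import Data.Fin.Permutation using (permutation)
  open import Data.List using (length)
  import Data.List.Properties as List
  import Data.List.Relation.Unary.All.Properties as All
  import Data.List.Relation.Unary.AllPairs.Properties as AllPairs
  import Algebra.Properties.CommutativeMonoid.Sum as Sum
  open Inverse card using (to; from; to-cong; strictlyInverseˡ; strictlyInverseʳ)

  to-injective : ∀ {x y} → to x ≡.≡ to y → x ≈ y
  to-injective {x} {y} tx≡ty = begin
    x            ≈⟨ strictlyInverseʳ x ⟨
    from (to x)  ≡⟨ ≡.cong from tx≡ty ⟩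
    from (to y)  ≈⟨ strictlyInverseʳ y ⟩
    y            ∎

  _≟_ : Decidable _≈_
  x ≟ y with to x Fin.≟ to y
  ... | yes tx≡ty = yes (to-injective tx≡ty)
  ... | no tx≢ty  = no (tx≢ty ∘ to-cong)

  card≢1 : suc k ≢ 1
  card≢1 1+k≡1 = Fin.¬Fin0 (≡.subst Fin (ℕ.suc-injective 1+k≡1) (punchOut (1≉0 ∘ to-injective)))

  from-injective : ∀ {i j} → from i ≈ from j → i ≡.≡ j
  from-injective {i} {j} eq = ≡.trans (≡.sym (strictlyInverseˡ i)) (≡.trans (to-cong eq) (strictlyInverseˡ j))

  ∃-nonZero-value : ∀ (f : C → C) → (∀ {x y} → x ≈ y → f x ≈ f y) → ¬ (∀ x → f x ≈ 0#) →
                    ∃ λ x → f x ≉ 0#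
  ∃-nonZero-value f f-cong f≉0 with Fin.¬∀⟶∃¬ (suc k) (λ i → f (from i) ≈ 0#) (λ i → f (from i) ≟ 0#) ¬f∘from≈0
    where
    ¬f∘from≈0 : ¬ (∀ i → f (from i) ≈ 0#)
    ¬f∘from≈0 f∘from≈0 = f≉0 λ x → trans (f-cong (sym (strictlyInverseʳ x))) (f∘from≈0 (to x))
  ... | i , fi≉0 = from i , fi≉0

  vanishes-everywhere⇒card≤degree : ∀ cs → (∀ x → monic cs x ≈ 0#) → suc k ≤ length cs
  vanishes-everywhere⇒card≤degree cs f≈0 = ≡.subst (_≤ length cs) (List.length-tabulate from)
    (roots≤degree cs (AllPairs.tabulate⁺ (λ i≢j → i≢j ∘ from-injective)) (All.tabulate⁺ (f≈0 ∘ from)))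

  module ∑ = Sum +-commutativeMonoid
  module Π = Sum *-commutativeMonoid

  module Reindex (σ σ⁻¹ : C → C)
                 (σ-cong : ∀ {x y} → x ≈ y → σ x ≈ σ y) (σ⁻¹-cong : ∀ {x y} → x ≈ y → σ⁻¹ x ≈ σ⁻¹ y)
                 (σσ⁻¹ : ∀ x → σ (σ⁻¹ x) ≈ x) (σ⁻¹σ : ∀ x → σ⁻¹ (σ x) ≈ x)
                 (M : CommutativeMonoid c ℓ) (h : C → CommutativeMonoid.Carrier M)
                 (h-cong : ∀ {x y} → x ≈ y → CommutativeMonoid._≈_ M (h x) (h y)) where
    open CommutativeMonoid M using () renaming (_≈_ to _≈ᴹ_; trans to transᴹ)
    open Sum M using (sum; sum-permute; sum-cong-≋)

    sum-reindex : sum (h ∘ from) ≈ᴹ sum (h ∘ σ ∘ from)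
    sum-reindex = transᴹ (sum-permute (h ∘ from) π) (sum-cong-≋ (h-cong ∘ strictlyInverseʳ ∘ σ ∘ from))
      where
      π = permutation (to ∘ σ ∘ from) (to ∘ σ⁻¹ ∘ from)
            (λ i → ≡.trans (to-cong (trans (σ-cong (strictlyInverseʳ _)) (σσ⁻¹ _))) (strictlyInverseˡ i))
            (λ i → ≡.trans (to-cong (trans (σ⁻¹-cong (strictlyInverseʳ _)) (σ⁻¹σ _))) (strictlyInverseˡ i))

  -- Translation by 1 permutes F, so ∑ F = ∑ F + q · 1.
  card·1≈0 : ι (suc k) ≈ 0#
  card·1≈0 = sym (+-cancelˡ S 0# (ι (suc k)) (begin
    S + 0#                        ≈⟨ +-identityʳ S ⟩
    S                             ≈⟨ Translate.sum-reindex ⟩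
    ∑.sum (λ i → from i + 1#)     ≈⟨ ∑.∑-distrib-+ from (λ _ → 1#) ⟩
    S + ∑.sum {suc k} (λ _ → 1#)  ≈⟨ +-congˡ (∑.sum-replicate (suc k)) ⟩
    S + ι (suc k)                 ∎))
    where
    S = ∑.sum from
    module Translate = Reindex (_+ 1#) (_- 1#) +-congʳ +-congʳ
      (λ x → trans (+-assoc x (- 1#) 1#) (trans (+-congˡ (-‿inverseˡ 1#)) (+-identityʳ x)))
      (λ x → trans (+-assoc x 1# (- 1#)) (trans (+-congˡ (-‿inverseʳ 1#)) (+-identityʳ x)))
      +-commutativeMonoid (λ x → x) (λ x≈y → x≈y)

  ∏-nonZero : ∀ {n} (f : Fin n → C) → (∀ j → f j ≉ 0#) → Π.sum f ≉ 0#
  ∏-nonZero {zero}  f f≉0 = 1≉0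
  ∏-nonZero {suc n} f f≉0 = *-nonZero (f≉0 Fin.zero) (∏-nonZero (f ∘ Fin.suc) (f≉0 ∘ Fin.suc))

  -- Replacing 0 by 1 turns the product over all elements into the product over the units.
  zeroToOne : C → C
  zeroToOne y with y ≟ 0#
  ... | yes _ = 1#
  ... | no _  = y

  zeroToOne-0 : ∀ {y} → y ≈ 0# → zeroToOne y ≈ 1#
  zeroToOne-0 {y} y≈0 with y ≟ 0#
  ... | yes _   = refl
  ... | no y≉0 = ⊥-elim (y≉0 y≈0)

  zeroToOne-nonZero : ∀ {y} → y ≉ 0# → zeroToOne y ≈ y
  zeroToOne-nonZero {y} y≉0 with y ≟ 0#
  ... | yes y≈0 = ⊥-elim (y≉0 y≈0)
  ... | no _    = refl

  zeroToOne-cong : ∀ {x y} → x ≈ y → zeroToOne x ≈ zeroToOne y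
  zeroToOne-cong {x} {y} x≈y with y ≟ 0#
  ... | yes y≈0 = zeroToOne-0 (trans x≈y y≈0)
  ... | no y≉0  = trans (zeroToOne-nonZero (y≉0 ∘ trans (sym x≈y))) x≈y

  units : Fin k → C
  units j = from (punchIn (to 0#) j)

  units-nonZero : ∀ j → units j ≉ 0#
  units-nonZero j uj≈0 = Fin.punchInᵢ≢i (to 0#) j (≡.trans (≡.sym (strictlyInverseˡ _)) (to-cong uj≈0))

  ∏-zeroToOne : ∀ (f : C → C) → (∀ {x y} → x ≈ y → f x ≈ f y) → f 0# ≈ 0# →
                (∀ {y} → y ≉ 0# → f y ≉ 0#) → Π.sum (zeroToOne ∘ f ∘ from) ≈ Π.sum (f ∘ units)
  ∏-zeroToOne f f-cong f0≈0 f≉0 = begin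
    Π.sum (zeroToOne ∘ f ∘ from)                                  ≈⟨ Π.sum-remove {i = to 0#} (zeroToOne ∘ f ∘ from) ⟩
    zeroToOne (f (from (to 0#))) * Π.sum (zeroToOne ∘ f ∘ units)
      ≈⟨ *-cong (zeroToOne-0 (trans (f-cong (strictlyInverseʳ 0#)) f0≈0))
                (Π.sum-cong-≋ (zeroToOne-nonZero ∘ f≉0 ∘ units-nonZero)) ⟩
    1# * Π.sum (f ∘ units)                                         ≈⟨ *-identityˡ _ ⟩
    Π.sum (f ∘ units)                                              ∎

  -- Multiplication by x permutes the units, so ∏ units = xᵏ · ∏ units.
  x^k≈1 : ∀ {x} → x ≉ 0# → x ^ k ≈ 1#
  x^k≈1 {x} x≉0 = *-cancelˡ-nonZero (x ^ k) 1# (∏-nonZero units units-nonZero) (begin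
    P * x ^ k                                 ≈⟨ *-comm P (x ^ k) ⟩
    x ^ k * P                                 ≈⟨ *-congʳ (Π.sum-replicate k) ⟨
    Π.sum {k} (λ _ → x) * P                   ≈⟨ Π.∑-distrib-+ (λ _ → x) units ⟨
    Π.sum (λ j → x * units j)                 ≈⟨ ∏-zeroToOne (x *_) *-congˡ (zeroʳ x) (*-nonZero x≉0) ⟨
    Π.sum (λ i → zeroToOne (x * from i))      ≈⟨ Scale.sum-reindex ⟨
    Π.sum (zeroToOne ∘ from)                  ≈⟨ ∏-zeroToOne (λ y → y) (λ x≈y → x≈y) refl (λ y≉0 → y≉0) ⟩
    P                                         ≈⟨ *-identityʳ P ⟨
    P * 1#                                    ∎)
    where
    P = Π.sum units
    module Scale = Reindex (x *_) (inverse x x≉0 *_) *-congˡ *-congˡ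
      (x*[x⁻¹*y]≈y x≉0) (x⁻¹*[x*y]≈y x≉0) *-commutativeMonoid zeroToOne zeroToOne-cong

  x^card≈x : ∀ x → x ^ suc k ≈ x
  x^card≈x x with x ≟ 0#
  ... | yes x≈0 = trans (*-congʳ x≈0) (trans (zeroˡ _) (sym x≈0))
  ... | no x≉0  = trans (*-congˡ (x^k≈1 x≉0)) (*-identityʳ x)

module Characteristic {c ℓ : Level} (F : CommutativeRing c ℓ) (isField : IsField F)
                      {p : ℕ} (p-prime : Prime p) (char-p : F HasCharacteristic p) where

  open FieldProperties F isField
  open MonicPolynomials F isField
  open import Data.Nat.Divisibility using (_∣_; divides)
  open import Data.Nat.Combinatorics using (nCn≡1) renaming (_C_ to _choose_)
  open import Data.Nat.Coprimality using (prime⇒coprime; coprime-Bézout)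
  open import Data.Nat.GCD using (module Bézout)
  import Data.Nat.Properties as ℕ
  open import Data.Fin as Fin using (Fin; toℕ; inject₁; fromℕ)
  import Data.Fin.Properties as Fin
  open import Data.List using (List; _∷_; length; replicate)
  import Data.List.Properties as List
  open import Data.List.Relation.Unary.All using (_∷_)
  open import Data.List.Relation.Unary.AllPairs using (_∷_)
  import Data.List.Relation.Unary.All.Properties as All
  import Data.List.Relation.Unary.AllPairs.Properties as AllPairs
  open import Relation.Binary using (Decidable; tri<; tri≈; tri>)
  open import Algebra.Properties.CommutativeSemiring.Binomial commutativeSemiring using (theorem; binomialTerm)
  open import Algebra.Properties.Semiring.Sum semiring using (sum; sum-init-last; sum-cong-≋; sum-replicate-zero)

  p∣n⇒n×x≈0 : ∀ {n} x → p ∣ n → n ×ℕ x ≈ 0#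
  p∣n⇒n×x≈0 x (divides d ≡.refl) = begin
    (d ℕ.* p) ×ℕ x       ≈⟨ n×x≈ι[n]*x (d ℕ.* p) x ⟩
    ι (d ℕ.* p) * x      ≈⟨ *-congʳ (×1-homo-* d p) ⟩
    (ι d * ι p) * x      ≈⟨ *-congʳ (trans (*-congˡ char-p) (zeroʳ (ι d))) ⟩
    0# * x               ≈⟨ zeroˡ x ⟩
    0#                   ∎

  [x+y]^p≈x^p+y^p : ∀ x y → (x + y) ^ p ≈ x ^ p + y ^ p
  [x+y]^p≈x^p+y^p x y with prime>1 p-prime
  ... | s≤s (s≤s {n = q} _) = begin
    (x + y) ^ p                               ≈⟨ theorem p x y ⟩
    t Fin.zero + sum (t ∘ Fin.suc)            ≈⟨ +-congˡ (sum-init-last (t ∘ Fin.suc)) ⟩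
    t Fin.zero + (sum (t ∘ Fin.suc ∘ inject₁) + t (Fin.suc (fromℕ (suc q))))
      ≈⟨ +-cong first (+-cong (trans (sum-cong-≋ middle) (sum-replicate-zero (suc q))) last) ⟩
    y ^ p + (0# + x ^ p)                      ≈⟨ +-congˡ (+-identityˡ _) ⟩
    y ^ p + x ^ p                             ≈⟨ +-comm _ _ ⟩
    x ^ p + y ^ p                             ∎
    where
    t = binomialTerm x y p
    first : t Fin.zero ≈ y ^ p
    first = trans (+-identityʳ _) (*-identityˡ _)
    middle : ∀ i → t (Fin.suc (inject₁ i)) ≈ 0#
    middle i = p∣n⇒n×x≈0 _ (prime∣pCk p-prime (s≤s z≤n)
      (s≤s (≡.subst (_< suc q) (≡.sym (Fin.toℕ-inject₁ i)) (Fin.toℕ<n i))))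
    last : t (Fin.suc (fromℕ (suc q))) ≈ x ^ p
    last = begin
      t (Fin.suc (fromℕ (suc q)))               ≡⟨ ≡.cong (λ k → (p choose k) ×ℕ (x ^ k * y ^ (p ℕ.∸ k)))
                                                           (≡.cong suc (Fin.toℕ-fromℕ (suc q))) ⟩
      (p choose p) ×ℕ (x ^ p * y ^ (p ℕ.∸ p))  ≈⟨ ×-cong (nCn≡1 p) (*-congˡ (^-congʳ y (ℕ.n∸n≡0 p))) ⟩
      1 ×ℕ (x ^ p * 1#)                         ≈⟨ +-identityʳ _ ⟩
      x ^ p * 1#                                ≈⟨ *-identityʳ _ ⟩
      x ^ p                                     ∎

  [x+y]^pⁱ≈x^pⁱ+y^pⁱ : ∀ i x y → (x + y) ^ (p ℕ.^ i) ≈ x ^ (p ℕ.^ i) + y ^ (p ℕ.^ i)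
  [x+y]^pⁱ≈x^pⁱ+y^pⁱ zero    x y = trans (*-identityʳ _) (sym (+-cong (*-identityʳ x) (*-identityʳ y)))
  [x+y]^pⁱ≈x^pⁱ+y^pⁱ (suc i) x y = begin
    (x + y) ^ (p ℕ.* p ℕ.^ i)                  ≈⟨ ^-assocʳ (x + y) p (p ℕ.^ i) ⟨
    ((x + y) ^ p) ^ (p ℕ.^ i)                  ≈⟨ ^-congˡ (p ℕ.^ i) ([x+y]^p≈x^p+y^p x y) ⟩
    (x ^ p + y ^ p) ^ (p ℕ.^ i)                ≈⟨ [x+y]^pⁱ≈x^pⁱ+y^pⁱ i (x ^ p) (y ^ p) ⟩
    (x ^ p) ^ (p ℕ.^ i) + (y ^ p) ^ (p ℕ.^ i)  ≈⟨ +-cong (^-assocʳ x p _) (^-assocʳ y p _) ⟩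
    x ^ (p ℕ.* p ℕ.^ i) + y ^ (p ℕ.* p ℕ.^ i)  ∎

  -- In characteristic p these are exactly the elements of the prime field (see 𝔽ₚ-elements below).
  _∈𝔽ₚ : C → Set ℓ
  a ∈𝔽ₚ = a ^ p ≈ a

  a∈𝔽ₚ⇒a^pⁱ≈a : ∀ {a} → a ∈𝔽ₚ → ∀ i → a ^ (p ℕ.^ i) ≈ a
  a∈𝔽ₚ⇒a^pⁱ≈a {a} a∈𝔽ₚ zero    = *-identityʳ a
  a∈𝔽ₚ⇒a^pⁱ≈a {a} a∈𝔽ₚ (suc i) = begin
    a ^ (p ℕ.* p ℕ.^ i)    ≈⟨ ^-assocʳ a p (p ℕ.^ i) ⟨
    (a ^ p) ^ (p ℕ.^ i)    ≈⟨ ^-congˡ (p ℕ.^ i) a∈𝔽ₚ ⟩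
    a ^ (p ℕ.^ i)          ≈⟨ a∈𝔽ₚ⇒a^pⁱ≈a a∈𝔽ₚ i ⟩
    a                      ∎

  ι∈𝔽ₚ : ∀ n → ι n ∈𝔽ₚ
  ι∈𝔽ₚ zero    with prime>1 p-prime
  ... | s≤s _ = zeroˡ _
  ι∈𝔽ₚ (suc n) = trans ([x+y]^p≈x^p+y^p 1# (ι n)) (+-cong (1^n≈1 p) (ι∈𝔽ₚ n))

  x⁻¹∈𝔽ₚ : ∀ {x} → x ∈𝔽ₚ → (x≉0 : x ≉ 0#) → inverse x x≉0 ∈𝔽ₚ
  x⁻¹∈𝔽ₚ {x} x∈𝔽ₚ x≉0 = *-cancelˡ-nonZero (x⁻¹ ^ p) x⁻¹ x≉0 (begin
    x * x⁻¹ ^ p      ≈⟨ *-congʳ x∈𝔽ₚ ⟨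
    x ^ p * x⁻¹ ^ p  ≈⟨ ^-distrib-* x x⁻¹ p ⟨
    (x * x⁻¹) ^ p    ≈⟨ ^-congˡ p (x*x⁻¹≈1 x≉0) ⟩
    1# ^ p           ≈⟨ 1^n≈1 p ⟩
    1#               ≈⟨ x*x⁻¹≈1 x≉0 ⟨
    x * x⁻¹          ∎)
    where x⁻¹ = inverse x x≉0

  ι[a*m]≈0 : ∀ a {m} → ι m ≈ 0# → ι (a ℕ.* m) ≈ 0#
  ι[a*m]≈0 a {m} ιm≈0 = trans (×1-homo-* a m) (trans (*-congˡ ιm≈0) (zeroʳ (ι a)))

  ι[1+a*m]≈1 : ∀ a {m} → ι m ≈ 0# → ι (1 ℕ.+ a ℕ.* m) ≈ 1#
  ι[1+a*m]≈1 a ιm≈0 = trans (+-congˡ (ι[a*m]≈0 a ιm≈0)) (+-identityʳ 1#)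

  ι-nonZero : ∀ {n} → 0 < n → n < p → ι n ≉ 0#
  ι-nonZero {suc n} _ n<p ιn≈0 with coprime-Bézout (prime⇒coprime p-prime n<p)
  ... | Bézout.+- a b 1+b[1+n]≡ap =
    1≉0 (trans (sym (ι[1+a*m]≈1 b ιn≈0)) (trans (reflexive (≡.cong ι 1+b[1+n]≡ap)) (ι[a*m]≈0 a char-p)))
  ... | Bézout.-+ a b 1+ap≡b[1+n] =
    1≉0 (trans (sym (ι[1+a*m]≈1 a char-p)) (trans (reflexive (≡.cong ι 1+ap≡b[1+n])) (ι[a*m]≈0 b ιn≈0)))

  m≤n⇒ι[n∸m]≈0 : ∀ {m n} → m ≤ n → ι m ≈ ι n → ι (n ℕ.∸ m) ≈ 0#
  m≤n⇒ι[n∸m]≈0 {m} {n} m≤n ιm≈ιn = +-cancelˡ (ι m) (ι (n ℕ.∸ m)) 0# (begin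
    ι m + ι (n ℕ.∸ m)  ≈⟨ ×-homo-+ 1# m (n ℕ.∸ m) ⟨
    ι (m ℕ.+ (n ℕ.∸ m)) ≡⟨ ≡.cong ι (ℕ.m+[n∸m]≡n m≤n) ⟩
    ι n                ≈⟨ ιm≈ιn ⟨
    ι m                ≈⟨ +-identityʳ (ι m) ⟨
    ι m + 0#           ∎)

  ι-injective : ∀ {m n} → m < p → n < p → ι m ≈ ι n → m ≡.≡ n
  ι-injective {m} {n} m<p n<p ιm≈ιn with ℕ.<-cmp m n
  ... | tri< m<n _ _ = ⊥-elim (ι-nonZero (ℕ.m<n⇒0<n∸m m<n) (ℕ.≤-<-trans (ℕ.m∸n≤m n m) n<p)
                                          (m≤n⇒ι[n∸m]≈0 (ℕ.<⇒≤ m<n) ιm≈ιn))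
  ... | tri≈ _ m≡n _ = m≡n
  ... | tri> _ _ n<m = ⊥-elim (ι-nonZero (ℕ.m<n⇒0<n∸m n<m) (ℕ.≤-<-trans (ℕ.m∸n≤m m n) m<p)
                                          (m≤n⇒ι[n∸m]≈0 (ℕ.<⇒≤ n<m) (sym ιm≈ιn)))

  xᵖ-x : List C
  xᵖ-x = 0# ∷ - 1# ∷ replicate (p ℕ.∸ 2) 0#

  length-xᵖ-x : length xᵖ-x ≡.≡ p
  length-xᵖ-x =
    ≡.trans (≡.cong (suc ∘ suc) (List.length-replicate (p ℕ.∸ 2))) (ℕ.m+[n∸m]≡n (prime>1 p-prime))

  𝔽ₚ-root : ∀ {y} → y ∈𝔽ₚ → monic xᵖ-x y ≈ 0#
  𝔽ₚ-root {y} y∈𝔽ₚ = begin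
    monic xᵖ-x y                                 ≈⟨ monic≈eval+x^deg xᵖ-x y ⟩
    (0# + y * (- 1# + y * eval zeros y)) + y ^ length xᵖ-x
      ≈⟨ +-cong (+-identityˡ _) (trans (^-congʳ y length-xᵖ-x) y∈𝔽ₚ) ⟩
    y * (- 1# + y * eval zeros y) + y            ≈⟨ +-congʳ (*-congˡ (+-congˡ (*-congˡ (eval-replicate-0 (p ℕ.∸ 2) y)))) ⟩
    y * (- 1# + y * 0#) + y                      ≈⟨ +-congʳ (*-congˡ (trans (+-congˡ (zeroʳ y)) (+-identityʳ _))) ⟩
    y * - 1# + y                                 ≈⟨ +-congʳ (-‿distribʳ-* y 1#) ⟨
    - (y * 1#) + y                               ≈⟨ +-congʳ (-‿cong (*-identityʳ y)) ⟩
    - y + y                                      ≈⟨ -‿inverseˡ y ⟩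
    0#                                           ∎
    where zeros = replicate (p ℕ.∸ 2) 0#

  -- Otherwise y, ι 0, …, ι (p - 1) would be p + 1 distinct roots of Xᵖ - X.
  𝔽ₚ-elements : Decidable _≈_ → ∀ {y} → y ∈𝔽ₚ → ∃ λ n → y ≈ ι n
  𝔽ₚ-elements _≟_ {y} y∈𝔽ₚ with Fin.any? (λ (i : Fin p) → y ≟ ι (toℕ i))
  ... | yes (i , y≈ιi) = toℕ i , y≈ιi
  ... | no ∄i          = ⊥-elim (ℕ.<-irrefl ≡.refl
          (≡.subst₂ _≤_ (≡.cong suc (List.length-tabulate ιᶠ)) length-xᵖ-x
            (roots≤degree xᵖ-x (All.tabulate⁺ (λ i y≈ιi → ∄i (i , y≈ιi)) ∷ AllPairs.tabulate⁺ ιᶠ-distinct)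
                               (𝔽ₚ-root y∈𝔽ₚ ∷ All.tabulate⁺ (𝔽ₚ-root ∘ ι∈𝔽ₚ ∘ toℕ)))))
    where
    ιᶠ : Fin p → C
    ιᶠ = ι ∘ toℕ
    ιᶠ-distinct : ∀ {i j} → i ≢ j → ιᶠ i ≉ ιᶠ j
    ιᶠ-distinct i≢j = i≢j ∘ Fin.toℕ-injective ∘ ι-injective (Fin.toℕ<n _) (Fin.toℕ<n _)

  Is𝔽ₚ-linear : (C → C) → Set (c ⊔ ℓ)
  Is𝔽ₚ-linear f = ∀ {a} → a ∈𝔽ₚ → ∀ x z → f (x - a * z) ≈ f x - a * f z

  kernel⊆kernel⇒proportional : ∀ {f g x₁} → Is𝔽ₚ-linear f → Is𝔽ₚ-linear g → (∀ x → f x ∈𝔽ₚ) →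
                               f x₁ ≈ 1# → (∀ x → f x ≈ 0# → g x ≈ 0#) → ∀ x → g x ≈ f x * g x₁
  kernel⊆kernel⇒proportional {f} {g} {x₁} f-linear g-linear f∈𝔽ₚ fx₁≈1 ker-f⊆ker-g x =
    x-y≈0⇒x≈y _ _ (trans (sym (g-linear (f∈𝔽ₚ x) x x₁)) (ker-f⊆ker-g _ (begin
      f (x - f x * x₁)  ≈⟨ f-linear (f∈𝔽ₚ x) x x₁ ⟩
      f x - f x * f x₁  ≈⟨ +-congˡ (-‿cong (trans (*-congˡ fx₁≈1) (*-identityʳ _))) ⟩
      f x - f x         ≈⟨ -‿inverseʳ _ ⟩
      0#                ∎)))

module Trace {c ℓ : Level} (F : CommutativeRing c ℓ) (isField : IsField F)
             {p : ℕ} (p-prime : Prime p) (char-p : F HasCharacteristic p) where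

  open FieldProperties F isField
  open MonicPolynomials F isField
  open Characteristic F isField p-prime char-p
  import Data.Nat.Properties as ℕ
  open import Data.List using (List; []; _∷_; length; _++_; replicate)
  import Data.List.Properties as List
  open import Algebra.Properties.Ring ring using (x+x≈x⇒x≈0; +-inverseʳ-unique)

  trace-suc : ∀ n x → trace F p (suc n) x ≈ trace F p n x + x ^ (p ℕ.^ n)
  trace-suc n x = +-congˡ (pow≈^ x (p ℕ.^ n))

  trace-cong : ∀ n {x y} → x ≈ y → trace F p n x ≈ trace F p n y
  trace-cong zero    x≈y = refl
  trace-cong (suc n) {x} {y} x≈y = begin
    trace F p (suc n) x                  ≈⟨ trace-suc n x ⟩
    trace F p n x + x ^ (p ℕ.^ n)        ≈⟨ +-cong (trace-cong n x≈y) (^-congˡ (p ℕ.^ n) x≈y) ⟩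
    trace F p n y + y ^ (p ℕ.^ n)        ≈⟨ trace-suc n y ⟨
    trace F p (suc n) y                  ∎

  trace-+ : ∀ n x y → trace F p n (x + y) ≈ trace F p n x + trace F p n y
  trace-+ zero    x y = sym (+-identityˡ 0#)
  trace-+ (suc n) x y = begin
    trace F p (suc n) (x + y)                                   ≈⟨ trace-suc n (x + y) ⟩
    trace F p n (x + y) + (x + y) ^ (p ℕ.^ n)   ≈⟨ +-cong (trace-+ n x y) ([x+y]^pⁱ≈x^pⁱ+y^pⁱ n x y) ⟩
    (Tx + Ty) + (xᵖⁿ + yᵖⁿ)                     ≈⟨ solve 4 (λ a b c d → (a :+ b) :+ (c :+ d) := (a :+ c) :+ (b :+ d))
                                                           refl Tx Ty xᵖⁿ yᵖⁿ ⟩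
    (Tx + xᵖⁿ) + (Ty + yᵖⁿ)                     ≈⟨ +-cong (trace-suc n x) (trace-suc n y) ⟨
    trace F p (suc n) x + trace F p (suc n) y   ∎
    where
    Tx = trace F p n x
    Ty = trace F p n y
    xᵖⁿ = x ^ (p ℕ.^ n)
    yᵖⁿ = y ^ (p ℕ.^ n)

  trace-0 : ∀ n → trace F p n 0# ≈ 0#
  trace-0 n = x+x≈x⇒x≈0 _ (trans (sym (trace-+ n 0# 0#)) (trace-cong n (+-identityʳ 0#)))

  trace-‿ : ∀ n x → trace F p n (- x) ≈ - trace F p n x
  trace-‿ n x = +-inverseʳ-unique (trace F p n x) (trace F p n (- x))
    (trans (sym (trace-+ n x (- x))) (trans (trace-cong n (-‿inverseʳ x)) (trace-0 n)))

  trace-scalar : ∀ {a} → a ∈𝔽ₚ → ∀ n x → trace F p n (a * x) ≈ a * trace F p n x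
  trace-scalar {a} a∈𝔽ₚ zero    x = sym (zeroʳ a)
  trace-scalar {a} a∈𝔽ₚ (suc n) x = begin
    trace F p (suc n) (a * x)                          ≈⟨ trace-suc n (a * x) ⟩
    trace F p n (a * x) + (a * x) ^ (p ℕ.^ n)
      ≈⟨ +-cong (trace-scalar a∈𝔽ₚ n x) (^-distrib-* a x (p ℕ.^ n)) ⟩
    a * trace F p n x + a ^ (p ℕ.^ n) * x ^ (p ℕ.^ n)  ≈⟨ +-congˡ (*-congʳ (a∈𝔽ₚ⇒a^pⁱ≈a a∈𝔽ₚ n)) ⟩
    a * trace F p n x + a * x ^ (p ℕ.^ n)              ≈⟨ distribˡ a _ _ ⟨
    a * (trace F p n x + x ^ (p ℕ.^ n))                ≈⟨ *-congˡ (trace-suc n x) ⟨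
    a * trace F p (suc n) x                            ∎

  trace-𝔽ₚ-linear : ∀ n → Is𝔽ₚ-linear (trace F p n)
  trace-𝔽ₚ-linear n a∈𝔽ₚ x z = trans (trace-+ n x _)
    (+-congˡ (trans (trace-‿ n _) (-‿cong (trace-scalar a∈𝔽ₚ n z))))

  trace^p : ∀ n y → trace F p n y ^ p ≈ (trace F p n y - y) + y ^ (p ℕ.^ n)
  trace^p zero y with prime>1 p-prime
  ... | s≤s _ = begin
    0# ^ p           ≈⟨ zeroˡ _ ⟩
    0#               ≈⟨ -‿inverseˡ y ⟨
    - y + y          ≈⟨ +-cong (+-identityˡ _) (*-identityʳ y) ⟨
    (0# - y) + y * 1# ∎
  trace^p (suc n) y = begin
    trace F p (suc n) y ^ p                    ≈⟨ ^-congˡ p (trace-suc n y) ⟩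
    (Ty + y ^ (p ℕ.^ n)) ^ p                   ≈⟨ [x+y]^p≈x^p+y^p Ty _ ⟩
    Ty ^ p + (y ^ (p ℕ.^ n)) ^ p
      ≈⟨ +-cong (trace^p n y) (trans (^-assocʳ y (p ℕ.^ n) p) (^-congʳ y (ℕ.*-comm (p ℕ.^ n) p))) ⟩
    ((Ty - y) + y ^ (p ℕ.^ n)) + y ^ (p ℕ.^ suc n)
      ≈⟨ +-congʳ (solve 3 (λ a b c → (a :+ b) :+ c := (a :+ c) :+ b) refl Ty (- y) (y ^ (p ℕ.^ n))) ⟩
    ((Ty + y ^ (p ℕ.^ n)) - y) + y ^ (p ℕ.^ suc n)  ≈⟨ +-congʳ (+-congʳ (trace-suc n y)) ⟨
    (trace F p (suc n) y - y) + y ^ (p ℕ.^ suc n)   ∎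
    where Ty = trace F p n y

  trace∈𝔽ₚ : ∀ n {y} → y ^ (p ℕ.^ n) ≈ y → trace F p n y ∈𝔽ₚ
  trace∈𝔽ₚ n {y} y^pⁿ≈y = begin
    trace F p n y ^ p                  ≈⟨ trace^p n y ⟩
    (trace F p n y - y) + y ^ (p ℕ.^ n) ≈⟨ +-congˡ y^pⁿ≈y ⟩
    (trace F p n y - y) + y             ≈⟨ +-assoc _ _ _ ⟩
    trace F p n y + (- y + y)           ≈⟨ +-congˡ (-‿inverseˡ y) ⟩
    trace F p n y + 0#                  ≈⟨ +-identityʳ _ ⟩
    trace F p n y                       ∎

  traceCoefficients : ℕ → List C
  traceCoefficients zero    = 0# ∷ []
  traceCoefficients (suc n) = traceCoefficients n ++ 1# ∷ replicate (p ℕ.^ suc n ℕ.∸ suc (p ℕ.^ n)) 0#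

  length-traceCoefficients : ∀ n → length (traceCoefficients n) ≡.≡ p ℕ.^ n
  length-traceCoefficients zero    = ≡.refl
  length-traceCoefficients (suc n) =
    ≡.trans (List.length-++ (traceCoefficients n))
   (≡.trans (≡.cong₂ (λ a b → a ℕ.+ suc b) (length-traceCoefficients n) (List.length-replicate k))
   (≡.trans (ℕ.+-suc (p ℕ.^ n) k)
            (ℕ.m+[n∸m]≡n (ℕ.^-monoʳ-< p (prime>1 p-prime) (ℕ.n<1+n n)))))
    where k = p ℕ.^ suc n ℕ.∸ suc (p ℕ.^ n)

  eval-traceCoefficients : ∀ n x → eval (traceCoefficients n) x ≈ trace F p n x
  eval-traceCoefficients zero    x = trans (+-identityˡ _) (zeroʳ x)
  eval-traceCoefficients (suc n) x = begin
    eval (traceCoefficients n ++ 1# ∷ replicate _ 0#) x                   ≈⟨ eval-++-monomial (traceCoefficients n) _ x ⟩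
    eval (traceCoefficients n) x + x ^ length (traceCoefficients n)
      ≈⟨ +-cong (eval-traceCoefficients n x) (^-congʳ x (length-traceCoefficients n)) ⟩
    trace F p n x + x ^ (p ℕ.^ n)                                         ≈⟨ trace-suc n x ⟨
    trace F p (suc n) x                                                   ∎

  trace-monic : ∀ n x → trace F p (suc n) x ≈ monic (traceCoefficients n) x
  trace-monic n x = begin
    trace F p (suc n) x                                                ≈⟨ trace-suc n x ⟩
    trace F p n x + x ^ (p ℕ.^ n)
      ≈⟨ +-cong (eval-traceCoefficients n x) (^-congʳ x (length-traceCoefficients n)) ⟨
    eval (traceCoefficients n) x + x ^ length (traceCoefficients n)    ≈⟨ monic≈eval+x^deg (traceCoefficients n) x ⟨
    monic (traceCoefficients n) x                                      ∎

module FiniteFieldTrace {c ℓ : Level} (F : CommutativeRing c ℓ) (isField : IsField F)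
                        {p : ℕ} (p-prime : Prime p) (m k : ℕ) (pᵐ≡1+k : p ℕ.^ m ≡.≡ suc k)
                        (card : HasCard F (suc k)) where

  open FieldProperties F isField
  open FiniteField F isField k card
  open import Algebra.Properties.CommutativeSemigroup *-commutativeSemigroup using (x∙yz≈y∙xz)
  import Data.Nat.Properties as ℕ

  char-p : F HasCharacteristic p
  char-p with ι p ≟ 0#
  ... | yes ιp≈0 = ιp≈0
  ... | no ιp≉0  = ⊥-elim (^-nonZero ιp≉0 m (begin
    ι p ^ m          ≈⟨ ι[m^n]≈ι[m]^n p m ⟨
    ι (p ℕ.^ m)      ≡⟨ ≡.cong ι pᵐ≡1+k ⟩
    ι (suc k)        ≈⟨ card·1≈0 ⟩
    0#               ∎))

  open Characteristic F isField p-prime char-p public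
  open Trace F isField p-prime char-p public

  trace[y]∈𝔽ₚ : ∀ y → trace F p m y ∈𝔽ₚ
  trace[y]∈𝔽ₚ y = trace∈𝔽ₚ m (trans (^-congʳ y pᵐ≡1+k) (x^card≈x y))

  -- trace (n + 1) is monic of degree pⁿ < p ^ (n + 1) = q, so it cannot vanish on all of F.
  pⁿ≡card⇒trace≉0 : ∀ n → p ℕ.^ n ≡.≡ suc k → ¬ (∀ y → trace F p n y ≈ 0#)
  pⁿ≡card⇒trace≉0 zero    1≡1+k _   = card≢1 (≡.sym 1≡1+k)
  pⁿ≡card⇒trace≉0 (suc n) pⁿ⁺¹≡1+k tr≈0 = ℕ.<⇒≱ (ℕ.^-monoʳ-< p (prime>1 p-prime) (ℕ.n<1+n n))
    (≡.subst₂ _≤_ (≡.sym pⁿ⁺¹≡1+k) (length-traceCoefficients n)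
      (vanishes-everywhere⇒card≤degree (traceCoefficients n) (λ y → trans (sym (trace-monic n y)) (tr≈0 y))))

  ∃trace≈1 : ∃ λ x → trace F p m x ≈ 1#
  ∃trace≈1 with ∃-nonZero-value (trace F p m) (trace-cong m) (pⁿ≡card⇒trace≉0 m pᵐ≡1+k)
  ... | y , tr[y]≉0 = inverse _ tr[y]≉0 * y , (begin
    trace F p m (inverse _ tr[y]≉0 * y)     ≈⟨ trace-scalar (x⁻¹∈𝔽ₚ (trace[y]∈𝔽ₚ y) tr[y]≉0) m y ⟩
    inverse _ tr[y]≉0 * trace F p m y       ≈⟨ *-comm _ _ ⟩
    trace F p m y * inverse _ tr[y]≉0       ≈⟨ x*x⁻¹≈1 tr[y]≉0 ⟩
    1#                                      ∎)

  trace-nondegenerate : ∀ {δ} → (∀ x → trace F p m (δ * x) ≈ 0#) → δ ≈ 0#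
  trace-nondegenerate {δ} tr[δx]≈0 with δ ≟ 0#
  ... | yes δ≈0 = δ≈0
  ... | no δ≉0  = ⊥-elim (1≉0 (begin
    1#                                     ≈⟨ proj₂ ∃trace≈1 ⟨
    trace F p m x₁                         ≈⟨ trace-cong m (x*[x⁻¹*y]≈y δ≉0 x₁) ⟨
    trace F p m (δ * (inverse δ δ≉0 * x₁)) ≈⟨ tr[δx]≈0 _ ⟩
    0#                                     ∎))
    where x₁ = proj₁ ∃trace≈1

  trace-form-linear : ∀ μ → Is𝔽ₚ-linear (λ x → trace F p m (μ * x))
  trace-form-linear μ {a} a∈𝔽ₚ x z =
    trans (trace-cong m μ[x-az]≈μx-a[μz]) (trace-𝔽ₚ-linear m a∈𝔽ₚ (μ * x) (μ * z))
    where
    μ[x-az]≈μx-a[μz] : μ * (x - a * z) ≈ μ * x - a * (μ * z)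
    μ[x-az]≈μx-a[μz] = trans (x[y-z]≈xy-xz μ x (a * z)) (+-congˡ (-‿cong (x∙yz≈y∙xz μ a z)))

  trace-forms-proportional : ∀ {μ ν} → μ ≉ 0# →
                             (∀ x → trace F p m (μ * x) ≈ 0# → trace F p m (ν * x) ≈ 0#) →
                             ∃ λ a → a ∈𝔽ₚ × ν ≈ a * μ
  trace-forms-proportional {μ} {ν} μ≉0 ker⊆ker = a , trace[y]∈𝔽ₚ _ , x-y≈0⇒x≈y ν (a * μ) (trace-nondegenerate tr[δx]≈0)
    where
    x₁ = inverse μ μ≉0 * proj₁ ∃trace≈1
    a  = trace F p m (ν * x₁)
    proportional : ∀ x → trace F p m (ν * x) ≈ trace F p m (μ * x) * a
    proportional = kernel⊆kernel⇒proportional (trace-form-linear μ) (trace-form-linear ν) (trace[y]∈𝔽ₚ ∘ (μ *_))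
      (trans (trace-cong m (x*[x⁻¹*y]≈y μ≉0 _)) (proj₂ ∃trace≈1)) ker⊆ker
    tr[δx]≈0 : ∀ x → trace F p m ((ν - a * μ) * x) ≈ 0#
    tr[δx]≈0 x = begin
      trace F p m ((ν - a * μ) * x)                      ≈⟨ trace-cong m (distribʳ x ν _) ⟩
      trace F p m (ν * x + - (a * μ) * x)                ≈⟨ trace-cong m (+-congˡ (-‿distribˡ-* (a * μ) x)) ⟨
      trace F p m (ν * x - (a * μ) * x)                  ≈⟨ trace-cong m (+-congˡ (-‿cong (*-assoc a μ x))) ⟩
      trace F p m (ν * x - a * (μ * x))                  ≈⟨ trace-𝔽ₚ-linear m (trace[y]∈𝔽ₚ _) (ν * x) (μ * x) ⟩
      trace F p m (ν * x) - a * trace F p m (μ * x)      ≈⟨ +-congʳ (trans (proportional x) (*-comm _ a)) ⟩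
      a * trace F p m (μ * x) - a * trace F p m (μ * x)  ≈⟨ -‿inverseʳ _ ⟩
      0#                                                 ∎

module RingHomomorphism {c ℓ : Level} (F : CommutativeRing c ℓ)
                        (g : CommutativeRing.Carrier F → CommutativeRing.Carrier F)
                        (g-hom : IsRingHomomorphism (CommutativeRing.rawRing F) (CommutativeRing.rawRing F) g) where

  open RingProperties F
  open IsRingHomomorphism g-hom using (⟦⟧-cong; +-homo; *-homo; 0#-homo; 1#-homo)

  g-ι : ∀ n → g (ι n) ≈ ι n
  g-ι zero    = 0#-homo
  g-ι (suc n) = trans (+-homo 1# (ι n)) (+-cong 1#-homo (g-ι n))

  g-pow : ∀ x n → g (pow F x n) ≈ pow F (g x) n
  g-pow x zero    = 1#-homo
  g-pow x (suc n) = trans (*-homo x _) (*-congˡ (g-pow x n))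

  g-trace : ∀ p n x → g (trace F p n x) ≈ trace F p n (g x)
  g-trace p zero    x = 0#-homo
  g-trace p (suc n) x = trans (+-homo _ _) (+-cong (g-trace p n x) (g-pow x (p ℕ.^ n)))

  iter[x]≈a*iter[1+n][x] : ∀ {a x} → x ≈ a * g x → g a ≈ a → ∀ n → iter F g n x ≈ a * iter F g (suc n) x
  iter[x]≈a*iter[1+n][x] x≈a*gx ga≈a zero    = x≈a*gx
  iter[x]≈a*iter[1+n][x] {a} x≈a*gx ga≈a (suc n) = begin
    g (iter F g n _)                 ≈⟨ ⟦⟧-cong (iter[x]≈a*iter[1+n][x] x≈a*gx ga≈a n) ⟩
    g (a * iter F g (suc n) _)       ≈⟨ *-homo a _ ⟩
    g a * iter F g (suc (suc n)) _   ≈⟨ *-congʳ ga≈a ⟩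
    a * iter F g (suc (suc n)) _     ∎

  x≈aⁿ*iter[n][x] : ∀ {a x} → x ≈ a * g x → g a ≈ a → ∀ n → x ≈ a ^ n * iter F g n x
  x≈aⁿ*iter[n][x] {a} {x} x≈a*gx ga≈a zero    = sym (*-identityˡ x)
  x≈aⁿ*iter[n][x] {a} {x} x≈a*gx ga≈a (suc n) = begin
    x                                     ≈⟨ x≈aⁿ*iter[n][x] x≈a*gx ga≈a n ⟩
    a ^ n * iter F g n x                  ≈⟨ *-congˡ (iter[x]≈a*iter[1+n][x] x≈a*gx ga≈a n) ⟩
    a ^ n * (a * iter F g (suc n) x)      ≈⟨ x∙yz≈y∙xz (a ^ n) a _ ⟩
    a * (a ^ n * iter F g (suc n) x)      ≈⟨ *-assoc a (a ^ n) _ ⟨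
    a ^ suc n * iter F g (suc n) x        ∎
    where open import Algebra.Properties.CommutativeSemigroup *-commutativeSemigroup using (x∙yz≈y∙xz)

module FiniteFieldAutomorphism {c ℓ : Level} (F : CommutativeRing c ℓ) (isField : IsField F)
                               {p : ℕ} (p-prime : Prime p) (m k : ℕ) (pᵐ≡1+k : p ℕ.^ m ≡.≡ suc k)
                               (card : HasCard F (suc k))
                               (g : CommutativeRing.Carrier F → CommutativeRing.Carrier F) (g-aut : IsAut F g) where

  open FieldProperties F isField
  open FiniteField F isField k card using (_≟_)
  open FiniteFieldTrace F isField p-prime m k pᵐ≡1+k card
  open IsRingIsomorphism g-aut using (isRingHomomorphism; injective; ⟦⟧-cong; *-homo; 0#-homo)
  open RingHomomorphism F g isRingHomomorphism

  g-fixes-𝔽ₚ : ∀ {a} → a ∈𝔽ₚ → g a ≈ a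
  g-fixes-𝔽ₚ a∈𝔽ₚ with 𝔽ₚ-elements _≟_ a∈𝔽ₚ
  ... | n , a≈ιn = trans (⟦⟧-cong a≈ιn) (trans (g-ι n) (sym a≈ιn))

  invariant-kernel⇒kernel⊆kernel : ∀ {μ ν} → g ν ≈ μ →
    (∀ x → trace F p m (μ * x) ≈ 0# → trace F p m (μ * g x) ≈ 0#) →
    ∀ x → trace F p m (μ * x) ≈ 0# → trace F p m (ν * x) ≈ 0#
  invariant-kernel⇒kernel⊆kernel {μ} {ν} gν≈μ K-invariant x tr[μx]≈0 = injective (begin
    g (trace F p m (ν * x))    ≈⟨ g-trace p m (ν * x) ⟩
    trace F p m (g (ν * x))    ≈⟨ trace-cong m (trans (*-homo ν x) (*-congʳ gν≈μ)) ⟩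
    trace F p m (μ * g x)      ≈⟨ K-invariant x tr[μx]≈0 ⟩
    0#                         ≈⟨ 0#-homo ⟨
    g 0#                       ∎)

  scaled-preimage⇒eigenvector : ∀ {μ ν a} → g ν ≈ μ → ν ≈ a * μ → a ∈𝔽ₚ → μ ≈ a * g μ
  scaled-preimage⇒eigenvector {μ} {ν} {a} gν≈μ ν≈aμ a∈𝔽ₚ = begin
    μ          ≈⟨ gν≈μ ⟨
    g ν        ≈⟨ ⟦⟧-cong ν≈aμ ⟩
    g (a * μ)  ≈⟨ *-homo a μ ⟩
    g a * g μ  ≈⟨ *-congʳ (g-fixes-𝔽ₚ a∈𝔽ₚ) ⟩
    a * g μ    ∎

  -- Since aᵖ = a, the scaling factor disappears after p^r steps, where g itself is the identity.
  eigenvector⇒fixed : ∀ {μ a} r → IsIdentity F (iter F g (p ℕ.^ r)) → μ ≉ 0# → a ∈𝔽ₚ → μ ≈ a * g μ →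
                      g μ ≈ μ
  eigenvector⇒fixed {μ} {a} r gᵖʳ≈id μ≉0 a∈𝔽ₚ μ≈a*gμ = sym (*-cancelˡ-nonZero μ (g μ) a≉0 (begin
    a * μ                                   ≈⟨ *-congʳ (a∈𝔽ₚ⇒a^pⁱ≈a a∈𝔽ₚ r) ⟨
    a ^ (p ℕ.^ r) * μ                       ≈⟨ *-congˡ (gᵖʳ≈id μ) ⟨
    a ^ (p ℕ.^ r) * iter F g (p ℕ.^ r) μ    ≈⟨ x≈aⁿ*iter[n][x] μ≈a*gμ (g-fixes-𝔽ₚ a∈𝔽ₚ) (p ℕ.^ r) ⟨
    μ                                       ≈⟨ μ≈a*gμ ⟩
    a * g μ                                 ∎))
    where
    a≉0 : a ≉ 0#
    a≉0 a≈0 = μ≉0 (trans μ≈a*gμ (trans (*-congʳ a≈0) (zeroˡ (g μ))))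

hasCard⇒nonEmpty : ∀ {c ℓ} (F : CommutativeRing c ℓ) {n} → HasCard F n → ∃ λ k → n ≡.≡ suc k
hasCard⇒nonEmpty F {zero}  card = ⊥-elim (Fin.¬Fin0 (Inverse.to card (CommutativeRing.0# F)))
  where import Data.Fin.Properties as Fin
hasCard⇒nonEmpty F {suc k} _    = k , ≡.refl

open import Data.Nat using (_^_)

lemma3p5 : {c ℓ : Level} (p m r : ℕ) → Prime p →
    (F : CommutativeRing c ℓ) → IsField F → HasCard F (p ^ m) →
    (g : CommutativeRing.Carrier F → CommutativeRing.Carrier F) →
    IsAut F g → HasOrder F g (p ^ r) →
    (μ : CommutativeRing.Carrier F) →
    (∀ x → CommutativeRing._≈_ F (trace F p m (CommutativeRing._*_ F μ x)) (CommutativeRing.0# F) →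
           CommutativeRing._≈_ F (trace F p m (CommutativeRing._*_ F μ (g x))) (CommutativeRing.0# F)) →
    CommutativeRing._≈_ F (g μ) μ
lemma3p5 p m r p-prime F isField card g g-aut g-order μ K-invariant with hasCard⇒nonEmpty F card
... | k , pᵐ≡1+k = gμ≈μ
  where
  card₁ : HasCard F (suc k)
  card₁ = ≡.subst (HasCard F) pᵐ≡1+k card

  open FieldProperties F isField
  open FiniteField F isField k card₁ using (_≟_)
  open FiniteFieldTrace F isField p-prime m k pᵐ≡1+k card₁
  open FiniteFieldAutomorphism F isField p-prime m k pᵐ≡1+k card₁ g g-aut
  open IsRingIsomorphism g-aut using (surjective; ⟦⟧-cong; 0#-homo)

  ν : C
  ν = proj₁ (surjective μ)

  gν≈μ : g ν ≈ μ
  gν≈μ = proj₂ (surjective μ) refl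

  gμ≈μ : g μ ≈ μ
  gμ≈μ with μ ≟ 0#
  ... | yes μ≈0 = trans (⟦⟧-cong μ≈0) (trans 0#-homo (sym μ≈0))
  ... | no μ≉0 with trace-forms-proportional μ≉0 (invariant-kernel⇒kernel⊆kernel gν≈μ K-invariant)
  ...   | a , a∈𝔽ₚ , ν≈aμ =
    eigenvector⇒fixed r (proj₁ g-order) μ≉0 a∈𝔽ₚ (scaled-preimage⇒eigenvector gν≈μ ν≈aμ a∈𝔽ₚ)
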